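{- Every nontrivial congruence equation fails in some finitary variety of logic, i.e., in some variety that is the equivalent algebraic semantics of some finitely algebraizable finitary logic.
   Context: A congruence equation is a formal equation between terms in binary symbols $\land,\lor,\circ$. It is satisfied by an algebra $\mathbf{B}$ if it holds whenever its variables are interpreted as congruences of $\mathbf{B}$, with $\alpha\land\beta:=\alpha\cap\beta$, $\alpha\lor\beta:=\Theta^{\mathbf{B}}(\alpha\cup\beta)$ (the congruence generated by $\alpha\cup\beta$) and $\alpha\circ\beta$ the relational product, applied to arbitrary binary relations on $B$. It is satisfied by a class if satisfied by every member; it is nontrivial if some algebra fails to satisfy it. A variety (class of similar algebras closed under homomorphic images, subalgebras and direct products) $\mathsf{K}$ is a finitary variety of logic if there are finite sets $I,J$, unary terms $\delta_i,\varepsilon_i$ ($i\in I$) and binary terms $\rho_j$ ($j\in J$) in the signature of $\mathsf{K}$ such that $\big(\&_{i\in I,\,j\in J}\ \delta_i(\rho_j(x,y))\approx\varepsilon_i(\rho_j(x,y))\big)\Longleftrightarrow x\approx y$ is valid in every member of $\mathsf{K}$. (Equivalently, $\mathsf{K}$ is the equivalent algebraic semantics of a finitely algebraizable finitary sentential logic.) -}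

module Defs where

open import Level using (Level; _⊔_) renaming (suc to lsuc)
open import Data.Sum using (_⊎_)
open import Data.Nat using (ℕ)
open import Data.Fin using (Fin; zero; suc)
open import Data.Product using (Σ; Σ-syntax; _×_; _,_)
open import Relation.Binary using (Rel; IsEquivalence)
open import Relation.Nullary using (¬_)

record Signature (ℓ : Level) : Set (lsuc ℓ) where
  field
    Op    : Set ℓ
    arity : Op → ℕ
open Signature public

data Term {ℓ} (S : Signature ℓ) (X : Set) : Set ℓ where
  var : X → Term S X
  op  : (f : Op S) → (Fin (arity S f) → Term S X) → Term S X

-- An algebra whose equality is a setoid equality _≈_ (quotients are not
-- available in Agda; homomorphic images are taken up to _≈_).
record Algebra {ℓ} (S : Signature ℓ) : Set (lsuc ℓ) where
  field
    Carrier : Set ℓ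
    _≈_     : Rel Carrier ℓ
    isEquiv : IsEquivalence _≈_
    ⟦_⟧op   : (f : Op S) → (Fin (arity S f) → Carrier) → Carrier
    op-cong : ∀ f (as bs : Fin (arity S f) → Carrier) →
              (∀ i → as i ≈ bs i) → ⟦ f ⟧op as ≈ ⟦ f ⟧op bs
open Algebra public

eval : ∀ {ℓ} {S : Signature ℓ} {X : Set} (A : Algebra S) →
       (X → Carrier A) → Term S X → Carrier A
eval A ρ (var x)   = ρ x
eval A ρ (op f ts) = ⟦ A ⟧op f (λ i → eval A ρ (ts i))

record Hom {ℓ} {S : Signature ℓ} (A B : Algebra S) : Set ℓ where
  field
    fun      : Carrier A → Carrier B
    fun-cong : ∀ {x y} → _≈_ A x y → _≈_ B (fun x) (fun y)
    fun-op   : ∀ f (as : Fin (arity S f) → Carrier A) →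
               _≈_ B (fun (⟦ A ⟧op f as)) (⟦ B ⟧op f (λ i → fun (as i)))
open Hom public

Surjective : ∀ {ℓ} {S : Signature ℓ} {A B : Algebra S} → Hom A B → Set ℓ
Surjective {A = A} {B} h = ∀ b → Σ (Carrier A) λ a → _≈_ B (fun h a) b

Injective : ∀ {ℓ} {S : Signature ℓ} {A B : Algebra S} → Hom A B → Set ℓ
Injective {A = A} {B} h = ∀ x y → _≈_ B (fun h x) (fun h y) → _≈_ A x y

Π-alg : ∀ {ℓ} {S : Signature ℓ} (I : Set ℓ) → (I → Algebra S) → Algebra S
Π-alg {S = S} I A = record
  { Carrier = (i : I) → Carrier (A i)
  ; _≈_     = λ x y → ∀ i → _≈_ (A i) (x i) (y i)
  ; isEquiv = record
      { refl  = λ {x} i → IsEquivalence.refl (isEquiv (A i))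
      ; sym   = λ p i → IsEquivalence.sym (isEquiv (A i)) (p i)
      ; trans = λ p q i → IsEquivalence.trans (isEquiv (A i)) (p i) (q i)
      }
  ; ⟦_⟧op   = λ f as i → ⟦ A i ⟧op f (λ k → as k i)
  ; op-cong = λ f as bs p i → op-cong (A i) f (λ k → as k i) (λ k → bs k i) (λ k → p k i)
  }

record IsVariety {ℓ} {S : Signature ℓ} (K : Algebra S → Set (lsuc ℓ)) : Set (lsuc ℓ) where
  field
    closed-H : ∀ (A B : Algebra S) → K A → (h : Hom A B) → Surjective h → K B
    closed-S : ∀ (A B : Algebra S) → K A → (h : Hom B A) → Injective h → K B
    closed-P : ∀ (I : Set ℓ) (A : I → Algebra S) → (∀ i → K (A i)) → K (Π-alg I A)

x,y : ∀ {a} {A : Set a} → A → A → Fin 2 → A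
x,y a b zero    = a
x,y a b (suc _) = b

IsFinitaryVarietyOfLogic : ∀ {ℓ} {S : Signature ℓ} → (Algebra S → Set (lsuc ℓ)) → Set (lsuc ℓ)
IsFinitaryVarietyOfLogic {S = S} K =
  IsVariety K ×
  (Σ ℕ λ m → Σ ℕ λ n →
   Σ (Fin m → Term S (Fin 1)) λ δ → Σ (Fin m → Term S (Fin 1)) λ ε →
   Σ (Fin n → Term S (Fin 2)) λ ρ →
     ∀ (A : Algebra S) → K A → ∀ (x y : Carrier A) →
       ((∀ i j → _≈_ A (eval A (λ _ → eval A (x,y x y) (ρ j)) (δ i))
                         (eval A (λ _ → eval A (x,y x y) (ρ j)) (ε i)))
          → _≈_ A x y)
       × (_≈_ A x y →
          ∀ i j → _≈_ A (eval A (λ _ → eval A (x,y x y) (ρ j)) (δ i))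
                         (eval A (λ _ → eval A (x,y x y) (ρ j)) (ε i))))

record Congruence {ℓ} {S : Signature ℓ} (A : Algebra S) : Set (lsuc ℓ) where
  field
    rel     : Rel (Carrier A) ℓ
    isEq    : IsEquivalence rel
    ≈⊆rel   : ∀ {x y} → _≈_ A x y → rel x y
    compat  : ∀ f (as bs : Fin (arity S f) → Carrier A) →
              (∀ i → rel (as i) (bs i)) → rel (⟦ A ⟧op f as) (⟦ A ⟧op f bs)
open Congruence public

data Θ {ℓ} {S : Signature ℓ} (A : Algebra S) (R : Rel (Carrier A) ℓ) :
       Rel (Carrier A) ℓ where
  gen   : ∀ {x y} → R x y → Θ A R x y
  eq    : ∀ {x y} → _≈_ A x y → Θ A R x y
  sym   : ∀ {x y} → Θ A R x y → Θ A R y x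
  trans : ∀ {x y z} → Θ A R x y → Θ A R y z → Θ A R x z
  comp  : ∀ f (as bs : Fin (arity S f) → Carrier A) →
          (∀ i → Θ A R (as i) (bs i)) → Θ A R (⟦ A ⟧op f as) (⟦ A ⟧op f bs)

data CTerm (n : ℕ) : Set where
  v    : Fin n → CTerm n
  _∧_  : CTerm n → CTerm n → CTerm n
  _∨_  : CTerm n → CTerm n → CTerm n
  _∘_  : CTerm n → CTerm n → CTerm n

record CEquation : Set where
  constructor mkCEq
  field
    {nvars} : ℕ
    lhs rhs : CTerm nvars
open CEquation public

⟦_⟧C : ∀ {ℓ} {S : Signature ℓ} {A : Algebra S} {n : ℕ} →
       CTerm n → (Fin n → Congruence A) → Rel (Carrier A) ℓ
⟦ v i ⟧C σ       = rel (σ i)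
⟦ s ∧ t ⟧C σ x y = ⟦ s ⟧C σ x y × ⟦ t ⟧C σ x y
⟦_⟧C {A = A} (s ∨ t) σ = Θ A (λ x y → ⟦ s ⟧C σ x y ⊎ ⟦ t ⟧C σ x y)
⟦_⟧C {A = A} (s ∘ t) σ x z = Σ (Carrier A) λ y → ⟦ s ⟧C σ x y × ⟦ t ⟧C σ y z

SatisfiesCEq : ∀ {ℓ} {S : Signature ℓ} → Algebra S → CEquation → Set (lsuc ℓ)
SatisfiesCEq A e =
  ∀ (σ : Fin (nvars e) → Congruence A) (x y : Carrier A) →
    (⟦ lhs e ⟧C σ x y → ⟦ rhs e ⟧C σ x y) × (⟦ rhs e ⟧C σ x y → ⟦ lhs e ⟧C σ x y)

ClassSatisfiesCEq : ∀ {ℓ} {S : Signature ℓ} → (Algebra S → Set (lsuc ℓ)) → CEquation → Set (lsuc ℓ)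
ClassSatisfiesCEq {S = S} K e = ∀ (A : Algebra S) → K A → SatisfiesCEq A e

Nontrivial : (ℓ : Level) → CEquation → Set (lsuc ℓ)
Nontrivial ℓ e = Σ (Signature ℓ) λ S → Σ (Algebra S) λ B → ¬ SatisfiesCEq B e

-- Given an algebra B witnessing that e is nontrivial, expand its signature by
-- binary operations m₀, m₁ and a unary s, and let K be the variety of
--   m₀ (m₀ x y) (m₁ x y) ≈ x,   m₀ (s (m₀ x y)) (s (m₁ x y)) ≈ y,   s (mᵢ x x) ≈ mᵢ x x.
-- These identities make x ≈ y equivalent to s (mᵢ x y) ≈ mᵢ x y for i = 0, 1,
-- so K is a finitary variety of logic. The square B × B, with
-- mᵢ ((a₀ , a₁) , (b₀ , b₁)) = (aᵢ , bᵢ) and s the swap, lies in K; every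
-- congruence term evaluated at squared congruences θ × θ is the square of
-- its value on B, so B × B fails e because B does.
module Submission where

open import Defs
open import Level using (Level; Lift; lift; lower) renaming (suc to lsuc)
open import Data.Product using (Σ; _×_; _,_; proj₁; proj₂; swap)
import Data.Product as Product
open import Data.Product.Relation.Binary.Pointwise.NonDependent
  using (Pointwise; ×-isEquivalence)
open import Data.Sum using (_⊎_; inj₁; inj₂; [_,_])
open import Data.Nat using (ℕ)
open import Data.Fin using (Fin; zero; suc)
open import Relation.Binary using (Rel; IsEquivalence; Setoid; _⇒_)
open import Relation.Nullary using (¬_)
import Relation.Binary.Reasoning.Setoid as SetoidReasoning

private
  variable
    ℓ : Level
    X : Set

setoid : {S : Signature ℓ} → Algebra S → Setoid ℓ ℓ
setoid A = record { isEquivalence = isEquiv A }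

module _ {S : Signature ℓ} (A : Algebra S) where

  eval-cong : {ρ ρ' : X → Carrier A} → (∀ x → _≈_ A (ρ x) (ρ' x)) →
              ∀ t → _≈_ A (eval A ρ t) (eval A ρ' t)
  eval-cong p (var x)   = p x
  eval-cong p (op f ts) = op-cong A f _ _ (λ i → eval-cong p (ts i))

  Compatible : Rel (Carrier A) ℓ → Set ℓ
  Compatible R = ∀ f as bs → (∀ i → R (as i) (bs i)) → R (⟦ A ⟧op f as) (⟦ A ⟧op f bs)

  Θ-congruence : Rel (Carrier A) ℓ → Congruence A
  Θ-congruence R = record
    { rel    = Θ A R
    ; isEq   = record { refl = eq (IsEquivalence.refl (isEquiv A)) ; sym = sym ; trans = trans }
    ; ≈⊆rel  = eq
    ; compat = comp
    }

  Θ-least : ∀ {R} (θ : Congruence A) → R ⇒ rel θ → Θ A R ⇒ rel θ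
  Θ-least θ R⊆θ (gen r)           = R⊆θ r
  Θ-least θ R⊆θ (eq p)            = ≈⊆rel θ p
  Θ-least θ R⊆θ (sym p)           = IsEquivalence.sym (isEq θ) (Θ-least θ R⊆θ p)
  Θ-least θ R⊆θ (trans p q)       =
    IsEquivalence.trans (isEq θ) (Θ-least θ R⊆θ p) (Θ-least θ R⊆θ q)
  Θ-least θ R⊆θ (comp f as bs ps) = compat θ f as bs (λ i → Θ-least θ R⊆θ (ps i))

eval-hom : {S : Signature ℓ} {A B : Algebra S} (h : Hom A B) (ρ : X → Carrier A) →
           ∀ t → _≈_ B (fun h (eval A ρ t)) (eval B (λ x → fun h (ρ x)) t)
eval-hom {B = B} h ρ (var x)   = IsEquivalence.refl (isEquiv B)
eval-hom {B = B} h ρ (op f ts) =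
  IsEquivalence.trans (isEquiv B) (fun-op h f _) (op-cong B f _ _ (λ i → eval-hom h ρ (ts i)))

eval-Π : {S : Signature ℓ} (I : Set ℓ) (A : I → Algebra S) (ρ : X → Carrier (Π-alg I A)) →
         ∀ t i → _≈_ (A i) (eval (Π-alg I A) ρ t i) (eval (A i) (λ x → ρ x i) t)
eval-Π I A ρ (var x)   i = IsEquivalence.refl (isEquiv (A i))
eval-Π I A ρ (op f ts) i = op-cong (A i) f _ _ (λ k → eval-Π I A ρ (ts k) i)

_⊨_ : {S : Signature ℓ} → Algebra S → Term S X × Term S X → Set ℓ
A ⊨ (t , u) = ∀ ρ → _≈_ A (eval A ρ t) (eval A ρ u)

module _ {S : Signature ℓ} {E : Term S X × Term S X} where

  ⊨-image : {A B : Algebra S} (h : Hom A B) → Surjective h → A ⊨ E → B ⊨ E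
  ⊨-image {A = A} {B} h surj A⊨E ρ = begin
    eval B ρ t                          ≈⟨ eval-cong B lift-ρ t ⟩
    eval B (λ x → fun h (ρ̃ x)) t        ≈⟨ eval-hom h ρ̃ t ⟨
    fun h (eval A ρ̃ t)                  ≈⟨ fun-cong h (A⊨E ρ̃) ⟩
    fun h (eval A ρ̃ u)                  ≈⟨ eval-hom h ρ̃ u ⟩
    eval B (λ x → fun h (ρ̃ x)) u        ≈⟨ eval-cong B lift-ρ u ⟨
    eval B ρ u                          ∎
    where
    open SetoidReasoning (setoid B)
    t u : Term S X
    t = proj₁ E
    u = proj₂ E
    ρ̃ : X → Carrier A
    ρ̃ x = proj₁ (surj (ρ x))
    lift-ρ : ∀ x → _≈_ B (ρ x) (fun h (ρ̃ x))
    lift-ρ x = IsEquivalence.sym (isEquiv B) (proj₂ (surj (ρ x)))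

  ⊨-subalgebra : {A B : Algebra S} (h : Hom B A) → Injective h → A ⊨ E → B ⊨ E
  ⊨-subalgebra {A = A} h inj A⊨E ρ = inj _ _ (begin
    fun h (eval _ ρ (proj₁ E))          ≈⟨ eval-hom h ρ (proj₁ E) ⟩
    eval A (λ x → fun h (ρ x)) (proj₁ E) ≈⟨ A⊨E (λ x → fun h (ρ x)) ⟩
    eval A (λ x → fun h (ρ x)) (proj₂ E) ≈⟨ eval-hom h ρ (proj₂ E) ⟨
    fun h (eval _ ρ (proj₂ E))          ∎)
    where open SetoidReasoning (setoid A)

  ⊨-Π : (I : Set ℓ) (A : I → Algebra S) → (∀ i → A i ⊨ E) → Π-alg I A ⊨ E
  ⊨-Π I A A⊨E ρ i = begin
    eval (Π-alg I A) ρ (proj₁ E) i      ≈⟨ eval-Π I A ρ (proj₁ E) i ⟩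
    eval (A i) (λ x → ρ x i) (proj₁ E)  ≈⟨ A⊨E i (λ x → ρ x i) ⟩
    eval (A i) (λ x → ρ x i) (proj₂ E)  ≈⟨ eval-Π I A ρ (proj₂ E) i ⟨
    eval (Π-alg I A) ρ (proj₂ E) i      ∎
    where open SetoidReasoning (setoid (A i))

ModelsOf : {S : Signature ℓ} {I : Set} → (I → Term S X × Term S X) → Algebra S → Set (lsuc ℓ)
ModelsOf {ℓ = ℓ} E A = Lift (lsuc ℓ) (∀ i → A ⊨ E i)

ModelsOf-isVariety : {S : Signature ℓ} {I : Set} (E : I → Term S X × Term S X) → IsVariety (ModelsOf E)
ModelsOf-isVariety E = record
  { closed-H = λ A B A⊨ h surj → lift λ i → ⊨-image {E = E i} h surj (lower A⊨ i)
  ; closed-S = λ A B A⊨ h inj → lift λ i → ⊨-subalgebra {E = E i} h inj (lower A⊨ i)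
  ; closed-P = λ I A A⊨ → lift λ i → ⊨-Π {E = E i} I A (λ k → lower (A⊨ k) i)
  }

data LogicOp (ℓ : Level) : Set ℓ where
  m : Fin 2 → LogicOp ℓ
  s : LogicOp ℓ

logicArity : LogicOp ℓ → ℕ
logicArity (m _) = 2
logicArity s     = 1

_⁺ : ∀ {ℓ} → Signature ℓ → Signature ℓ
_⁺ {ℓ} S = record { Op = Op S ⊎ LogicOp ℓ ; arity = [ arity S , logicArity ] }

module _ {S : Signature ℓ} where

  mᵗ : Fin 2 → Term (S ⁺) X → Term (S ⁺) X → Term (S ⁺) X
  mᵗ i t u = op (inj₂ (m i)) (x,y t u)

  sᵗ : Term (S ⁺) X → Term (S ⁺) X
  sᵗ t = op (inj₂ s) (λ _ → t)

  data LogicAxiom : Set where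
    split-x split-y : LogicAxiom
    s-fixes-m       : Fin 2 → LogicAxiom

  private
    x y : Term (S ⁺) (Fin 2)
    x = var zero
    y = var (suc zero)

  logicAxiom : LogicAxiom → Term (S ⁺) (Fin 2) × Term (S ⁺) (Fin 2)
  logicAxiom split-x       = mᵗ zero (mᵗ zero x y) (mᵗ (suc zero) x y) , x
  logicAxiom split-y       = mᵗ zero (sᵗ (mᵗ zero x y)) (sᵗ (mᵗ (suc zero) x y)) , y
  logicAxiom (s-fixes-m i) = sᵗ (mᵗ i x x) , mᵗ i x x

  LogicVariety : Algebra (S ⁺) → Set (lsuc ℓ)
  LogicVariety = ModelsOf logicAxiom

  module _ (A : Algebra (S ⁺)) where

    mᵗ-cong : ∀ i {ρ ρ' : X → Carrier A} {t t' u u'} →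
              _≈_ A (eval A ρ t) (eval A ρ' t') → _≈_ A (eval A ρ u) (eval A ρ' u') →
              _≈_ A (eval A ρ (mᵗ i t u)) (eval A ρ' (mᵗ i t' u'))
    mᵗ-cong i p q = op-cong A (inj₂ (m i)) _ _ λ { zero → p ; (suc zero) → q }

    sᵗ-cong : {ρ ρ' : X → Carrier A} {t t' : Term (S ⁺) X} →
              _≈_ A (eval A ρ t) (eval A ρ' t') → _≈_ A (eval A ρ (sᵗ t)) (eval A ρ' (sᵗ t'))
    sᵗ-cong p = op-cong A (inj₂ s) _ _ (λ _ → p)

  module _ (A : Algebra (S ⁺)) (A∈K : LogicVariety A) (a b : Carrier A) where
    open IsEquivalence (isEquiv A) using () renaming (refl to ≈-refl; sym to ≈-sym)
    open SetoidReasoning (setoid A)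

    private
      axiom : ∀ ax ρ → _≈_ A (eval A ρ (proj₁ (logicAxiom ax))) (eval A ρ (proj₂ (logicAxiom ax)))
      axiom = lower A∈K

    s-fixes-mᵢ⇒≈ : (∀ i → _≈_ A (eval A (x,y a b) (sᵗ (mᵗ i x y))) (eval A (x,y a b) (mᵗ i x y))) →
                   _≈_ A a b
    s-fixes-mᵢ⇒≈ fixed = begin
      a
        ≈⟨ axiom split-x (x,y a b) ⟨
      eval A (x,y a b) (mᵗ zero (mᵗ zero x y) (mᵗ (suc zero) x y))
        ≈⟨ mᵗ-cong A zero (fixed zero) (fixed (suc zero)) ⟨
      eval A (x,y a b) (mᵗ zero (sᵗ (mᵗ zero x y)) (sᵗ (mᵗ (suc zero) x y)))
        ≈⟨ axiom split-y (x,y a b) ⟩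
      b ∎

    ≈⇒s-fixes-mᵢ : _≈_ A a b →
                   ∀ i → _≈_ A (eval A (x,y a b) (sᵗ (mᵗ i x y))) (eval A (x,y a b) (mᵗ i x y))
    ≈⇒s-fixes-mᵢ a≈b i = begin
      eval A (x,y a b) (sᵗ (mᵗ i x y)) ≈⟨ sᵗ-cong A {t = mᵗ i x y} {t' = mᵗ i x x} diagonal ⟩
      eval A (x,y a a) (sᵗ (mᵗ i x x)) ≈⟨ axiom (s-fixes-m i) (x,y a a) ⟩
      eval A (x,y a a) (mᵗ i x x)      ≈⟨ diagonal ⟨
      eval A (x,y a b) (mᵗ i x y)      ∎
      where
      diagonal : _≈_ A (eval A (x,y a b) (mᵗ i x y)) (eval A (x,y a a) (mᵗ i x x))
      diagonal = mᵗ-cong A i ≈-refl (≈-sym a≈b)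

  LogicVariety-isFinitaryVarietyOfLogic : IsFinitaryVarietyOfLogic LogicVariety
  LogicVariety-isFinitaryVarietyOfLogic =
    ModelsOf-isVariety logicAxiom , 1 , 2 ,
    (λ _ → sᵗ (var zero)) , (λ _ → var zero) , (λ i → mᵗ i x y) ,
    λ A A∈K a b → (λ fixed → s-fixes-mᵢ⇒≈ A A∈K a b (fixed zero)) ,
                  (λ a≈b _ → ≈⇒s-fixes-mᵢ A A∈K a b a≈b)

module _ {S : Signature ℓ} (B : Algebra S) where
  private
    C = Carrier B

  component : Fin 2 → C × C → C
  component zero       = proj₁
  component (suc zero) = proj₂

  ⟦_⟧² : (f : Op (S ⁺)) → (Fin (arity (S ⁺) f) → C × C) → C × C
  ⟦ inj₁ g ⟧²     as = ⟦ B ⟧op g (λ i → proj₁ (as i)) , ⟦ B ⟧op g (λ i → proj₂ (as i))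
  ⟦ inj₂ (m i) ⟧² as = component i (as zero) , component i (as (suc zero))
  ⟦ inj₂ s ⟧²     as = swap (as zero)

  Pointwise-compatible : ∀ {R} → Compatible B R →
    ∀ f (as bs : Fin (arity (S ⁺) f) → C × C) →
    (∀ i → Pointwise R R (as i) (bs i)) → Pointwise R R (⟦ f ⟧² as) (⟦ f ⟧² bs)
  Pointwise-compatible R-compat (inj₁ g) as bs ps =
    R-compat g _ _ (λ i → proj₁ (ps i)) , R-compat g _ _ (λ i → proj₂ (ps i))
  Pointwise-compatible R-compat (inj₂ (m zero)) as bs ps       = proj₁ (ps zero) , proj₁ (ps (suc zero))
  Pointwise-compatible R-compat (inj₂ (m (suc zero))) as bs ps = proj₂ (ps zero) , proj₂ (ps (suc zero))
  Pointwise-compatible R-compat (inj₂ s) as bs ps              = swap (ps zero)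

  Square : Algebra (S ⁺)
  Square = record
    { Carrier = C × C
    ; _≈_     = Pointwise (_≈_ B) (_≈_ B)
    ; isEquiv = ×-isEquivalence (isEquiv B) (isEquiv B)
    ; ⟦_⟧op   = ⟦_⟧²
    ; op-cong = Pointwise-compatible {_≈_ B} (op-cong B)
    }

  Square∈LogicVariety : LogicVariety Square
  Square∈LogicVariety = lift λ where
      split-x       _ → refl²
      split-y       _ → refl²
      (s-fixes-m _) _ → refl²
    where
    refl² : ∀ {p} → _≈_ Square p p
    refl² = IsEquivalence.refl (isEquiv Square)

  square : Congruence B → Congruence Square
  square θ = record
    { rel    = Pointwise (rel θ) (rel θ)
    ; isEq   = ×-isEquivalence (isEq θ) (isEq θ)
    ; ≈⊆rel  = Product.map (≈⊆rel θ) (≈⊆rel θ)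
    ; compat = Pointwise-compatible {rel θ} (compat θ)
    }

  module _ {R : Rel (C × C) ℓ} {R' : Rel C ℓ} where

    Θ-square⁻ : R ⇒ Pointwise R' R' → Θ Square R ⇒ Pointwise (Θ B R') (Θ B R')
    Θ-square⁻ R⊆R'² = Θ-least Square (square (Θ-congruence B R')) (λ r → Product.map gen gen (R⊆R'² r))

    Θ-diagonal : (∀ {a c} → R' a c → R (a , a) (c , c)) →
                 ∀ {a c} → Θ B R' a c → Θ Square R (a , a) (c , c)
    Θ-diagonal R'⊆R (gen r)           = gen (R'⊆R r)
    Θ-diagonal R'⊆R (eq p)            = eq (p , p)
    Θ-diagonal R'⊆R (sym p)           = sym (Θ-diagonal R'⊆R p)
    Θ-diagonal R'⊆R (trans p q)       = trans (Θ-diagonal R'⊆R p) (Θ-diagonal R'⊆R q)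
    Θ-diagonal R'⊆R (comp g as bs ps) =
      comp (inj₁ g) (λ i → as i , as i) (λ i → bs i , bs i) (λ i → Θ-diagonal R'⊆R (ps i))

    -- (a , b) = m₀ ((a , a) , (b , b)), so the diagonal generates everything.
    Θ-square⁺ : (∀ {a c} → R' a c → R (a , a) (c , c)) →
                Pointwise (Θ B R') (Θ B R') ⇒ Θ Square R
    Θ-square⁺ R'⊆R {a , b} {c , d} (a~c , b~d) =
      comp (inj₂ (m zero)) (x,y (a , a) (b , b)) (x,y (c , c) (d , d))
        λ { zero → Θ-diagonal R'⊆R a~c ; (suc zero) → Θ-diagonal R'⊆R b~d }

  module _ {n : ℕ} (σ : Fin n → Congruence B) where
    private
      σ² : Fin n → Congruence Square
      σ² i = square (σ i)

    ⟦⟧C-square⁻ : ∀ t → ⟦ t ⟧C σ² ⇒ Pointwise (⟦ t ⟧C σ) (⟦ t ⟧C σ)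
    ⟦⟧C-square⁺ : ∀ t → Pointwise (⟦ t ⟧C σ) (⟦ t ⟧C σ) ⇒ ⟦ t ⟧C σ²

    ⟦⟧C-square⁻ (v i)   p       = p
    ⟦⟧C-square⁻ (t ∧ u) (p , q) =
      (proj₁ (⟦⟧C-square⁻ t p) , proj₁ (⟦⟧C-square⁻ u q)) ,
      (proj₂ (⟦⟧C-square⁻ t p) , proj₂ (⟦⟧C-square⁻ u q))
    ⟦⟧C-square⁻ (t ∨ u) p       = Θ-square⁻ (λ where
      (inj₁ r) → Product.map inj₁ inj₁ (⟦⟧C-square⁻ t r)
      (inj₂ r) → Product.map inj₂ inj₂ (⟦⟧C-square⁻ u r)) p
    ⟦⟧C-square⁻ (t ∘ u) ((z₁ , z₂) , p , q) =
      (z₁ , proj₁ (⟦⟧C-square⁻ t p) , proj₁ (⟦⟧C-square⁻ u q)) ,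
      (z₂ , proj₂ (⟦⟧C-square⁻ t p) , proj₂ (⟦⟧C-square⁻ u q))

    ⟦⟧C-square⁺ (v i)   p                         = p
    ⟦⟧C-square⁺ (t ∧ u) ((p₁ , q₁) , (p₂ , q₂))   =
      ⟦⟧C-square⁺ t (p₁ , p₂) , ⟦⟧C-square⁺ u (q₁ , q₂)
    ⟦⟧C-square⁺ (t ∨ u) p                         = Θ-square⁺ (λ where
      (inj₁ r) → inj₁ (⟦⟧C-square⁺ t (r , r))
      (inj₂ r) → inj₂ (⟦⟧C-square⁺ u (r , r))) p
    ⟦⟧C-square⁺ (t ∘ u) ((z₁ , p₁ , q₁) , (z₂ , p₂ , q₂)) =
      (z₁ , z₂) , ⟦⟧C-square⁺ t (p₁ , p₂) , ⟦⟧C-square⁺ u (q₁ , q₂)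

  Square-reflects-CEq : ∀ e → SatisfiesCEq Square e → SatisfiesCEq B e
  Square-reflects-CEq (mkCEq l r) Square⊨e σ a b
    with Square⊨e (λ i → square (σ i)) (a , a) (b , b)
  ... | l⇒r , r⇒l =
    (λ p → proj₁ (⟦⟧C-square⁻ σ r (l⇒r (⟦⟧C-square⁺ σ l (p , p))))) ,
    (λ p → proj₁ (⟦⟧C-square⁻ σ l (r⇒l (⟦⟧C-square⁺ σ r (p , p)))))

theorem3p5 : ∀ {ℓ : Level} (e : CEquation) → Nontrivial ℓ e →
    Σ (Signature ℓ) λ S → Σ (Algebra S → Set (lsuc ℓ)) λ K →
      IsFinitaryVarietyOfLogic K × ¬ ClassSatisfiesCEq K e
theorem3p5 e (S , B , B⊭e) =
  S ⁺ , LogicVariety , LogicVariety-isFinitaryVarietyOfLogic ,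
  λ K⊨e → B⊭e (Square-reflects-CEq B e (K⊨e (Square B) (Square∈LogicVariety B)))
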